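{- Let $A$ be a set. There is a one-to-one correspondence between the set $\aleph!A$ of finite-or-countable multisets over $A$ and the set $A^{\infty}=A^{*}\uplus A^{\omega}$ of finite or infinite words over $A$ taken modulo the equivalence relation $\simeq$ defined in the context.
   Context: A finite-or-countable multiset over $A$ is a function $A\to\overline{\mathbb{N}}=\mathbb{N}\cup\{\infty\}$ whose support (the set of elements with nonzero image) is finite or countable; $\aleph!A$ denotes the set of such multisets. $A^*$ is the set of finite words over $A$ and $A^\omega$ the set of infinite words. For a finite word $u$ and a finite or infinite word $w$, write $u\sqsubseteq w$ when there exists a finite prefix $v$ of $w$ such that $u$ is a prefix of $v$ modulo permutation of letters (i.e. $u$ is a prefix of some permutation of $v$). For $w_1,w_2\in A^\infty$, $w_1\simeq w_2$ iff for all $u\in A^*$, $u\sqsubseteq w_1\iff u\sqsubseteq w_2$. -}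

module Defs where

open import Data.Nat using (ℕ; zero; suc)
open import Data.List using (List; []; _∷_; take)
open import Data.List.Relation.Binary.Permutation.Propositional using (_↭_)
open import Data.Product using (Σ; ∃; _×_; _,_; proj₁; proj₂)
open import Data.Sum using (_⊎_; inj₁; inj₂)
open import Function using (_⇔_; mk⇔; _∘_)
open import Function.Bundles using (Equivalence)
open import Relation.Nullary using (¬_; Dec)
open import Relation.Binary using (Setoid; IsEquivalence)
open import Relation.Binary.PropositionalEquality using (_≡_; refl)

data ℕ∞ : Set where
  fin : ℕ → ℕ∞
  ∞   : ℕ∞

LEM : Set₁
LEM = (P : Set) → Dec P

module _ (A : Set) where

  Support : (A → ℕ∞) → Set
  Support m = Σ A (λ a → ¬ (m a ≡ fin zero))

  FinOrCountable : (A → ℕ∞) → Set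
  FinOrCountable m = Σ (Support m → ℕ) λ f →
    ∀ x y → f x ≡ f y → proj₁ x ≡ proj₁ y

  ℵ! : Set
  ℵ! = Σ (A → ℕ∞) FinOrCountable

  ℵ!-Setoid : Setoid _ _
  ℵ!-Setoid = record
    { Carrier = ℵ!
    ; _≈_ = λ m n → ∀ a → proj₁ m a ≡ proj₁ n a
    ; isEquivalence = record
      { refl = λ a → refl
      ; sym = λ p a → Relation.Binary.PropositionalEquality.sym (p a)
      ; trans = λ p q a → Relation.Binary.PropositionalEquality.trans (p a) (q a) } }

  A∞ : Set
  A∞ = List A ⊎ (ℕ → A)

  takeω : ℕ → (ℕ → A) → List A
  takeω zero    w = []
  takeω (suc n) w = w zero ∷ takeω n (w ∘ suc)

  IsPrefix : List A → A∞ → Set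
  IsPrefix v (inj₁ w) = ∃ λ n → v ≡ take n w
  IsPrefix v (inj₂ w) = ∃ λ n → v ≡ takeω n w

  ListPrefix : List A → List A → Set
  ListPrefix u v = ∃ λ n → u ≡ take n v

  _⊑_ : List A → A∞ → Set
  u ⊑ w = Σ (List A) λ v → IsPrefix v w × Σ (List A) λ v′ → (v′ ↭ v) × ListPrefix u v′

  _≃_ : A∞ → A∞ → Set
  w₁ ≃ w₂ = ∀ u → (u ⊑ w₁) ⇔ (u ⊑ w₂)

  A∞/≃ : Setoid _ _
  A∞/≃ = record
    { Carrier = A∞
    ; _≈_ = _≃_
    ; isEquivalence = record
      { refl = λ u → mk⇔ (λ x → x) (λ x → x)
      ; sym = λ p u → mk⇔ (Equivalence.from (p u)) (Equivalence.to (p u))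
      ; trans = λ p q u → mk⇔ (Equivalence.to (q u) ∘ Equivalence.to (p u))
                              (Equivalence.from (p u) ∘ Equivalence.from (q u)) } }

-- The multiplicity of a letter a in a word w is the supremum in ℕ̄ of the number of a's in the
-- finite prefixes of w.  Since a list u is a prefix of a permutation of v exactly when every letter
-- occurs in u at most as often as in v, u ⊑ w holds iff each letter occurs in u at most as often as
-- its multiplicity in w; testing u = aᵏ then shows that w₁ ≃ w₂ iff w₁ and w₂ have the same
-- multiplicities.  Multiplicities have countable support (send a letter to a position where it
-- occurs), and conversely a multiset c whose support is indexed injectively by ℕ is realised by
-- dovetailing: stage t is a finite list containing (t − n) ⊓ c(a) copies of the letter a of index n,
-- each stage extends the previous one, and the union of the stages is a finite or infinite word.
-- Excluded middle supplies equality tests on A, the multiplicities, and the decision whether the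
-- union is finite.

module Submission where

open import Defs
open import Data.Empty using (⊥-elim)
open import Data.List using (List; []; _∷_; _++_; take; length; replicate; filter)
open import Data.List.Properties using (++-identityʳ; ++-assoc; take-all; take-take; filter-++; length-++)
open import Data.List.Membership.Propositional using (_∈_)
open import Data.List.Membership.Propositional.Properties using (∈-∃++)
open import Data.List.Relation.Unary.Any using (here; there)
open import Data.List.Relation.Binary.Permutation.Propositional using (_↭_; ↭-refl; prep; ↭-sym; ↭-trans)
open import Data.List.Relation.Binary.Permutation.Propositional.Properties using (shift; ↭-length; filter-↭)
open import Data.Maybe using (Maybe; just; nothing)
open import Data.Maybe.Properties using (just-injective)
open import Data.Nat using (ℕ; zero; suc; _+_; _∸_; _⊓_; _⊔_; _≤_; _<_; _≤?_; _≤′_; ≤′-reflexive; ≤′-step; z≤n; s≤s)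
open import Data.Nat.Properties
open import Data.Product using (Σ; ∃; _×_; _,_; proj₁; proj₂; map₂)
open import Data.Sum using (_⊎_; inj₁; inj₂)
open import Data.Unit using (⊤; tt)
open import Function using (_⇔_; mk⇔; Equivalence; _∘_)
open import Function.Bundles using (Bijection)
open import Function.Properties.Equivalence using (⇔-setoid)
open import Level using (0ℓ)
open import Relation.Binary using (DecidableEquality)
open import Relation.Binary.PropositionalEquality using (_≡_; refl; sym; trans; cong; cong₂; subst; module ≡-Reasoning)
open import Relation.Nullary using (¬_; yes; no)
open import Relation.Nullary.Decidable using (decidable-stable)

import Relation.Binary.Reasoning.Setoid as SetoidReasoning

module ⇔-Reasoning = SetoidReasoning (⇔-setoid 0ℓ)

-- Comparing naturals with ℕ∞

infix 4 _≤∞_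
infixl 7 _⊓∞_

_≤∞_ : ℕ → ℕ∞ → Set
k ≤∞ fin m = k ≤ m
k ≤∞ ∞     = ⊤

≤-≤∞-trans : ∀ {j k} v → j ≤ k → k ≤∞ v → j ≤∞ v
≤-≤∞-trans (fin m) j≤k k≤m = ≤-trans j≤k k≤m
≤-≤∞-trans ∞       _   _   = tt

0≤∞ : ∀ v → 0 ≤∞ v
0≤∞ (fin m) = z≤n
0≤∞ ∞       = tt

≢fin0⇒1≤∞ : ∀ v → ¬ v ≡ fin 0 → 1 ≤∞ v
≢fin0⇒1≤∞ (fin zero)    v≢0 = ⊥-elim (v≢0 refl)
≢fin0⇒1≤∞ (fin (suc m)) _   = s≤s z≤n
≢fin0⇒1≤∞ ∞             _   = tt

≤∞-extensional : ∀ u v → (∀ k → k ≤∞ u ⇔ k ≤∞ v) → u ≡ v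
≤∞-extensional (fin m) (fin n) u≈v =
  cong fin (≤-antisym (Equivalence.to (u≈v m) ≤-refl) (Equivalence.from (u≈v n) ≤-refl))
≤∞-extensional (fin m) ∞       u≈v = ⊥-elim (1+n≰n (Equivalence.from (u≈v (suc m)) tt))
≤∞-extensional ∞       (fin n) u≈v = ⊥-elim (1+n≰n (Equivalence.to (u≈v (suc n)) tt))
≤∞-extensional ∞       ∞       _   = refl

_⊓∞_ : ℕ → ℕ∞ → ℕ
k ⊓∞ fin m = k ⊓ m
k ⊓∞ ∞     = k

0⊓∞v≡0 : ∀ v → 0 ⊓∞ v ≡ 0
0⊓∞v≡0 (fin m) = refl
0⊓∞v≡0 ∞       = refl

⊓∞-≤∞ : ∀ k v → k ⊓∞ v ≤∞ v
⊓∞-≤∞ k (fin m) = m⊓n≤n k m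
⊓∞-≤∞ k ∞       = tt

≤∞⇒⊓∞≡ : ∀ {k} v → k ≤∞ v → k ⊓∞ v ≡ k
≤∞⇒⊓∞≡ (fin m) k≤m = m≤n⇒m⊓n≡m k≤m
≤∞⇒⊓∞≡ ∞       _   = refl

⊓∞-monoˡ-≤ : ∀ {j k} v → j ≤ k → j ⊓∞ v ≤ k ⊓∞ v
⊓∞-monoˡ-≤ (fin m) j≤k = ⊓-monoˡ-≤ m j≤k
⊓∞-monoˡ-≤ ∞       j≤k = j≤k

-- Consequences of excluded middle on ℕ

module _ (lem : LEM) where

  ¬∀⇒∃¬ : {B : Set} {Q : B → Set} → ¬ (∀ x → Q x) → ∃ λ x → ¬ Q x
  ¬∀⇒∃¬ {Q = Q} ¬∀ with lem (∃ λ x → ¬ Q x)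
  ... | yes ∃¬ = ∃¬
  ... | no ¬∃¬ = ⊥-elim (¬∀ λ x → decidable-stable (lem (Q x)) λ ¬Qx → ¬∃¬ (x , ¬Qx))

  boundary : (Q : ℕ → Set) → Q 0 → ∀ k → ¬ Q k → ∃ λ m → Q m × ¬ Q (suc m)
  boundary Q q0 zero    ¬q = ⊥-elim (¬q q0)
  boundary Q q0 (suc k) ¬q with lem (Q k)
  ... | yes qk  = k , qk , ¬q
  ... | no ¬qk = boundary Q q0 k ¬qk

  downClosed⇒≤∞ : (Q : ℕ → Set) → Q 0 → (∀ {j k} → j ≤ k → Q k → Q j) →
                  Σ ℕ∞ λ v → ∀ k → Q k ⇔ k ≤∞ v
  downClosed⇒≤∞ Q q0 down with lem (∀ k → Q k)
  ... | yes all = ∞ , λ k → mk⇔ (λ _ → tt) (λ _ → all k)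
  ... | no ¬all with ¬∀⇒∃¬ ¬all
  ... | k , ¬qk with boundary Q q0 k ¬qk
  ... | m , qm , ¬qm+1 = fin m , λ j → mk⇔ (λ qj → ≮⇒≥ λ m<j → ¬qm+1 (down m<j qj)) (λ j≤m → down j≤m qm)

  bounded⇒max : (f : ℕ → ℕ) → ∀ N → (∀ t → f t ≤ N) → ∃ λ T → ∀ t → f t ≤ f T
  bounded⇒max f zero    f≤0 = 0 , λ t → ≤-trans (f≤0 t) z≤n
  bounded⇒max f (suc N) f≤N+1 with lem (∃ λ T → f T ≡ suc N)
  ... | yes (T , fT≡N+1) = T , λ t → subst (f t ≤_) (sym fT≡N+1) (f≤N+1 t)
  ... | no ¬hit = bounded⇒max f N λ t → ≤-pred (≤∧≢⇒< (f≤N+1 t) λ ft≡N+1 → ¬hit (t , ft≡N+1))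

  unbounded⇒above : (f : ℕ → ℕ) → ¬ (∃ λ N → ∀ t → f t ≤ N) → ∀ N → ∃ λ t → N < f t
  unbounded⇒above f ¬bounded N with lem (∃ λ t → N < f t)
  ... | yes above = above
  ... | no ¬above = ⊥-elim (¬bounded (N , λ t → ≮⇒≥ λ N<ft → ¬above (t , N<ft)))

-- Prefixes and limits of words

module _ {A : Set} where

  infix 4 _≼_

  _≼_ : List A → List A → Set
  xs ≼ ys = ∃ λ d → ys ≡ xs ++ d

  ≼-refl : ∀ {xs} → xs ≼ xs
  ≼-refl {xs} = [] , sym (++-identityʳ xs)

  ≼-trans : ∀ {xs ys zs} → xs ≼ ys → ys ≼ zs → xs ≼ zs
  ≼-trans {xs} (d , refl) (e , refl) = d ++ e , ++-assoc xs d e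

  take-length-≼ : ∀ {xs ys} → xs ≼ ys → take (length xs) ys ≡ xs
  take-length-≼ {[]}     _        = refl
  take-length-≼ {x ∷ xs} (d , refl) = cong (x ∷_) (take-length-≼ (d , refl))

  ≼-length-≥⇒≡ : ∀ {xs ys} → xs ≼ ys → length ys ≤ length xs → ys ≡ xs
  ≼-length-≥⇒≡ {[]}     ([]    , refl) _ = refl
  ≼-length-≥⇒≡ {x ∷ xs} (d     , refl) (s≤s len≤) = cong (x ∷_) (≼-length-≥⇒≡ (d , refl) len≤)

  _!!_ : List A → ℕ → Maybe A
  []       !! _     = nothing
  (x ∷ xs) !! zero  = just x
  (x ∷ xs) !! suc i = xs !! i

  !!-≼ : ∀ {xs ys i x} → xs ≼ ys → xs !! i ≡ just x → ys !! i ≡ just x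
  !!-≼ {x ∷ xs} {i = zero}  (d , refl) xs!!i = xs!!i
  !!-≼ {x ∷ xs} {i = suc i} (d , refl) xs!!i = !!-≼ {xs} (d , refl) xs!!i

  !!-comparable : ∀ {xs ys i x y} → xs ≼ ys ⊎ ys ≼ xs → xs !! i ≡ just x → ys !! i ≡ just y → x ≡ y
  !!-comparable (inj₁ xs≼ys) xs!!i ys!!i = just-injective (trans (sym (!!-≼ xs≼ys xs!!i)) ys!!i)
  !!-comparable (inj₂ ys≼xs) xs!!i ys!!i = just-injective (trans (sym xs!!i) (!!-≼ ys≼xs ys!!i))

  !!-defined : ∀ xs {i} → i < length xs → ∃ λ x → xs !! i ≡ just x
  !!-defined (x ∷ xs) {zero}  _         = x , refl
  !!-defined (x ∷ xs) {suc i} (s≤s i<n) = !!-defined xs i<n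

  ∈⇒!! : ∀ {x xs} → x ∈ xs → ∃ λ i → xs !! i ≡ just x
  ∈⇒!! (here refl)  = 0 , refl
  ∈⇒!! (there x∈xs) = let i , xs!!i = ∈⇒!! x∈xs in suc i , xs!!i

  ∈⇒↭∷ : ∀ {x : A} {xs} → x ∈ xs → ∃ λ r → xs ↭ x ∷ r
  ∈⇒↭∷ {x} x∈xs with ∈-∃++ x∈xs
  ... | ys , zs , refl = ys ++ zs , shift x ys zs

  takeω-≤ : ∀ {n n′} → n ≤ n′ → (s : ℕ → A) → takeω A n s ≡ take n (takeω A n′ s)
  takeω-≤ z≤n       s = refl
  takeω-≤ (s≤s n≤n′) s = cong (s 0 ∷_) (takeω-≤ n≤n′ (s ∘ suc))

  takeω-agrees : ∀ n (s : ℕ → A) xs → (∀ i → i < n → xs !! i ≡ just (s i)) → takeω A n s ≡ take n xs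
  takeω-agrees zero    s xs       _     = refl
  takeω-agrees (suc n) s []       agree with agree 0 (s≤s z≤n)
  ... | ()
  takeω-agrees (suc n) s (x ∷ xs) agree =
    cong₂ _∷_ (just-injective (sym (agree 0 (s≤s z≤n))))
              (takeω-agrees n (s ∘ suc) xs λ i i<n → agree (suc i) (s≤s i<n))

  prefix : ℕ → A∞ A → List A
  prefix n (inj₁ xs) = take n xs
  prefix n (inj₂ s)  = takeω A n s

  IsPrefix⇒prefix : ∀ {v} w → IsPrefix A v w → ∃ λ n → v ≡ prefix n w
  IsPrefix⇒prefix (inj₁ xs) v-prefix = v-prefix
  IsPrefix⇒prefix (inj₂ s)  v-prefix = v-prefix

  prefix-IsPrefix : ∀ n w → IsPrefix A (prefix n w) w
  prefix-IsPrefix n (inj₁ xs) = n , refl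
  prefix-IsPrefix n (inj₂ s)  = n , refl

  prefix-≤ : ∀ {n n′} → n ≤ n′ → ∀ w → prefix n w ≡ take n (prefix n′ w)
  prefix-≤ {n} {n′} n≤n′ (inj₁ xs) = sym (trans (take-take n n′ xs) (cong (λ m → take m xs) (m≤n⇒m⊓n≡m n≤n′)))
  prefix-≤ n≤n′ (inj₂ s) = takeω-≤ n≤n′ s

  at : A∞ A → ℕ → Maybe A
  at (inj₁ xs) i = xs !! i
  at (inj₂ s)  i = just (s i)

  prefix-!! : ∀ n w {i x} → prefix n w !! i ≡ just x → at w i ≡ just x
  prefix-!! n (inj₁ xs) = take-!! n xs
    where
      take-!! : ∀ n xs {i x} → take n xs !! i ≡ just x → xs !! i ≡ just x
      take-!! (suc n) (y ∷ ys) {zero}  e = e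
      take-!! (suc n) (y ∷ ys) {suc i} e = take-!! n ys e
  prefix-!! n (inj₂ s) = takeω-!! n s
    where
      takeω-!! : ∀ n (s : ℕ → A) {i x} → takeω A n s !! i ≡ just x → just (s i) ≡ just x
      takeω-!! (suc n) s {zero}  e = e
      takeω-!! (suc n) s {suc i} e = takeω-!! n (s ∘ suc) e

  IsChain : (ℕ → List A) → Set
  IsChain P = ∀ t → P t ≼ P (suc t)

  IsLimit : (ℕ → List A) → A∞ A → Set
  IsLimit P w = (∀ n → ∃ λ t → prefix n w ≡ take n (P t)) × (∀ t → ∃ λ n → prefix n w ≡ P t)

  module _ {P : ℕ → List A} (chain : IsChain P) where

    chain-≼ : ∀ {t t′} → t ≤′ t′ → P t ≼ P t′
    chain-≼ (≤′-reflexive refl) = ≼-refl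
    chain-≼ (≤′-step t≤′t′)     = ≼-trans (chain-≼ t≤′t′) (chain _)

    chain-comparable : ∀ t t′ → P t ≼ P t′ ⊎ P t′ ≼ P t
    chain-comparable t t′ with ≤-total t t′
    ... | inj₁ t≤t′ = inj₁ (chain-≼ (≤⇒≤′ t≤t′))
    ... | inj₂ t′≤t = inj₂ (chain-≼ (≤⇒≤′ t′≤t))

    longest-IsLimit : ∀ T → (∀ t → length (P t) ≤ length (P T)) → IsLimit P (inj₁ (P T))
    longest-IsLimit T longest = (λ n → T , refl) , stage
      where
        stage : ∀ t → ∃ λ n → take n (P T) ≡ P t
        stage t with chain-comparable t T
        ... | inj₁ Pt≼PT = length (P t) , take-length-≼ Pt≼PT
        ... | inj₂ PT≼Pt = length (P T) , trans (take-length-≼ ≼-refl) (sym (≼-length-≥⇒≡ PT≼Pt (longest t)))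

    unbounded-IsLimit : (∀ N → ∃ λ t → N < length (P t)) → ∃ λ s → IsLimit P (inj₂ s)
    unbounded-IsLimit above = s , prefix-stage , stage-prefix
      where
        s : ℕ → A
        s i = proj₁ (!!-defined (P (proj₁ (above i))) (proj₂ (above i)))
        agree : ∀ t i → i < length (P t) → P t !! i ≡ just (s i)
        agree t i i<len with !!-defined (P t) i<len
        ... | _ , Pt!!i = let t′ , i<len′ = above i in
          subst (λ y → P t !! i ≡ just y)
                (!!-comparable (chain-comparable t t′) Pt!!i (proj₂ (!!-defined (P t′) i<len′))) Pt!!i
        prefix-stage : ∀ n → ∃ λ t → takeω A n s ≡ take n (P t)
        prefix-stage n = let t , n<len = above n in
          t , takeω-agrees n s (P t) λ i i<n → agree t i (<-trans i<n n<len)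
        stage-prefix : ∀ t → ∃ λ n → takeω A n s ≡ P t
        stage-prefix t = length (P t) , trans (takeω-agrees _ s (P t) (agree t)) (take-all _ (P t) ≤-refl)

chain-limit : LEM → {A : Set} {P : ℕ → List A} → IsChain P → ∃ (IsLimit P)
chain-limit lem {P = P} chain with lem (∃ λ N → ∀ t → length (P t) ≤ N)
... | yes (N , bounded) = let T , longest = bounded⇒max lem (length ∘ P) N bounded in
                          inj₁ (P T) , longest-IsLimit chain T longest
... | no ¬bounded = let s , limit = unbounded-IsLimit chain (unbounded⇒above lem (length ∘ P) ¬bounded) in
                    inj₂ s , limit

-- Occurrence counts and multiplicities

LEM⇒DecidableEquality : LEM → (A : Set) → DecidableEquality A
LEM⇒DecidableEquality lem A x y = lem (x ≡ y)

module Counting {A : Set} (_≟_ : DecidableEquality A) where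

  count : A → List A → ℕ
  count a xs = length (filter (_≟ a) xs)

  count-++ : ∀ a xs ys → count a (xs ++ ys) ≡ count a xs + count a ys
  count-++ a xs ys = trans (cong length (filter-++ (_≟ a) xs ys)) (length-++ (filter (_≟ a) xs))

  count-take-≤ : ∀ a n xs → count a (take n xs) ≤ count a xs
  count-take-≤ a zero    xs       = z≤n
  count-take-≤ a (suc n) []       = z≤n
  count-take-≤ a (suc n) (x ∷ xs) with x ≟ a
  ... | yes _ = s≤s (count-take-≤ a n xs)
  ... | no  _ = count-take-≤ a n xs

  count-↭ : ∀ a {xs ys} → xs ↭ ys → count a xs ≡ count a ys
  count-↭ a xs↭ys = ↭-length (filter-↭ (_≟ a) xs↭ys)

  count-replicate : ∀ a k → count a (replicate k a) ≡ k
  count-replicate a zero    = refl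
  count-replicate a (suc k) with a ≟ a
  ... | yes _   = cong suc (count-replicate a k)
  ... | no  a≢a = ⊥-elim (a≢a refl)

  count-replicate-≢ : ∀ {a b} → ¬ a ≡ b → ∀ k → count b (replicate k a) ≡ 0
  count-replicate-≢ a≢b zero = refl
  count-replicate-≢ {a} {b} a≢b (suc k) with a ≟ b
  ... | yes a≡b = ⊥-elim (a≢b a≡b)
  ... | no  _   = count-replicate-≢ a≢b k

  count-head : ∀ x xs → 0 < count x (x ∷ xs)
  count-head x xs with x ≟ x
  ... | yes _   = s≤s z≤n
  ... | no  x≢x = ⊥-elim (x≢x refl)

  count-∷-cancel : ∀ {a} x {xs ys} → count a (x ∷ xs) ≤ count a (x ∷ ys) → count a xs ≤ count a ys
  count-∷-cancel {a} x with x ≟ a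
  ... | yes _ = ≤-pred
  ... | no  _ = λ xs≤ys → xs≤ys

  count⁺⇒∈ : ∀ {a xs} → 0 < count a xs → a ∈ xs
  count⁺⇒∈ {a} {x ∷ xs} pos with x ≟ a
  ... | yes refl = here refl
  ... | no  _    = there (count⁺⇒∈ pos)

  count-≤⇒++-↭ : ∀ u v → (∀ a → count a u ≤ count a v) → ∃ λ r → u ++ r ↭ v
  count-≤⇒++-↭ []      v _   = v , ↭-refl
  count-≤⇒++-↭ (x ∷ u) v u≤v with ∈⇒↭∷ (count⁺⇒∈ (≤-trans (count-head x u) (u≤v x)))
  ... | v₁ , v↭x∷v₁ =
    let r , u++r↭v₁ = count-≤⇒++-↭ u v₁ λ a →
          count-∷-cancel x (subst (count a (x ∷ u) ≤_) (count-↭ a v↭x∷v₁) (u≤v a))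
    in r , ↭-trans (prep x u++r↭v₁) (↭-sym v↭x∷v₁)

  AtLeast : ℕ → A → A∞ A → Set
  AtLeast k a w = ∃ λ n → k ≤ count a (prefix n w)

  AtLeast-zero : ∀ {a} w → AtLeast 0 a w
  AtLeast-zero w = 0 , z≤n

  AtLeast-≤ : ∀ {a} w {j k} → j ≤ k → AtLeast k a w → AtLeast j a w
  AtLeast-≤ w j≤k (n , k≤count) = n , ≤-trans j≤k k≤count

  count-prefix-mono : ∀ a {n n′} → n ≤ n′ → ∀ w → count a (prefix n w) ≤ count a (prefix n′ w)
  count-prefix-mono a {n} {n′} n≤n′ w =
    subst (λ v → count a v ≤ count a (prefix n′ w)) (sym (prefix-≤ n≤n′ w)) (count-take-≤ a n (prefix n′ w))

  ⊑⇒AtLeast : ∀ {u} w → _⊑_ A u w → ∀ a → AtLeast (count a u) a w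
  ⊑⇒AtLeast w (v , v-prefix , v′ , v′↭v , k , refl) a with IsPrefix⇒prefix w v-prefix
  ... | n , refl = n , ≤-trans (count-take-≤ a k v′) (≤-reflexive (count-↭ a v′↭v))

  maxOver : (A → ℕ) → List A → ℕ
  maxOver g []       = 0
  maxOver g (x ∷ xs) = g x ⊔ maxOver g xs

  ∈⇒≤maxOver : ∀ g {a xs} → a ∈ xs → g a ≤ maxOver g xs
  ∈⇒≤maxOver g (here refl)                = m≤m⊔n _ _
  ∈⇒≤maxOver g {xs = x ∷ xs} (there a∈xs) = ≤-trans (∈⇒≤maxOver g a∈xs) (m≤n⊔m (g x) _)

  AtLeast⇒⊑ : ∀ {u} w → (∀ a → AtLeast (count a u) a w) → _⊑_ A u w
  AtLeast⇒⊑ {u} w enough =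
    let r , u++r↭prefix = count-≤⇒++-↭ u (prefix N w) bound in
    prefix N w , prefix-IsPrefix N w , u ++ r , u++r↭prefix , length u , sym (take-length-≼ (r , refl))
    where
      N : ℕ
      N = maxOver (λ a → proj₁ (enough a)) u
      bound : ∀ a → count a u ≤ count a (prefix N w)
      bound a with m≤n⇒m<n∨m≡n (z≤n {count a u})
      ... | inj₁ pos   = ≤-trans (proj₂ (enough a))
        (count-prefix-mono a (∈⇒≤maxOver (λ b → proj₁ (enough b)) (count⁺⇒∈ {a} {u} pos)) w)
      ... | inj₂ 0≡cnt = subst (_≤ count a (prefix N w)) 0≡cnt z≤n

  Multiplicity : A∞ A → (A → ℕ∞) → Set
  Multiplicity w c = ∀ a k → AtLeast k a w ⇔ k ≤∞ c a

  ⊑⇔≤∞ : ∀ {w c} → Multiplicity w c → ∀ u → _⊑_ A u w ⇔ (∀ a → count a u ≤∞ c a)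
  ⊑⇔≤∞ {w} mult u = mk⇔ (λ u⊑w a → Equivalence.to (mult a _) (⊑⇒AtLeast w u⊑w a))
                        (λ u≤c → AtLeast⇒⊑ w λ a → Equivalence.from (mult a _) (u≤c a))

  replicate-≤∞ : ∀ (c : A → ℕ∞) k a → (∀ b → count b (replicate k a) ≤∞ c b) ⇔ k ≤∞ c a
  replicate-≤∞ c k a = mk⇔ (λ rep≤c → subst (_≤∞ c a) (count-replicate a k) (rep≤c a)) rep≤c
    where
      rep≤c : k ≤∞ c a → ∀ b → count b (replicate k a) ≤∞ c b
      rep≤c k≤c b with a ≟ b
      ... | yes refl = subst (_≤∞ c a) (sym (count-replicate a k)) k≤c
      ... | no  a≢b  = subst (_≤∞ c b) (sym (count-replicate-≢ a≢b k)) (0≤∞ (c b))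

  same-multiplicity⇒≃ : ∀ {w w′ c c′} → Multiplicity w c → Multiplicity w′ c′ →
                        (∀ a → c a ≡ c′ a) → _≃_ A w w′
  same-multiplicity⇒≃ {w} {w′} {c} {c′} mult mult′ c≡c′ u = begin
    _⊑_ A u w                  ≈⟨ ⊑⇔≤∞ mult u ⟩
    (∀ a → count a u ≤∞ c a)   ≈⟨ mk⇔ (λ u≤c a → subst (count a u ≤∞_) (c≡c′ a) (u≤c a))
                                      (λ u≤c′ a → subst (count a u ≤∞_) (sym (c≡c′ a)) (u≤c′ a)) ⟩
    (∀ a → count a u ≤∞ c′ a)  ≈⟨ ⊑⇔≤∞ mult′ u ⟨
    _⊑_ A u w′                 ∎
    where open ⇔-Reasoning

  ≃⇒same-multiplicity : ∀ {w w′ c c′} → Multiplicity w c → Multiplicity w′ c′ →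
                        _≃_ A w w′ → ∀ a → c a ≡ c′ a
  ≃⇒same-multiplicity {w} {w′} {c} {c′} mult mult′ w≃w′ a = ≤∞-extensional (c a) (c′ a) λ k → begin
    k ≤∞ c a                                  ≈⟨ replicate-≤∞ c k a ⟨
    (∀ b → count b (replicate k a) ≤∞ c b)    ≈⟨ ⊑⇔≤∞ mult (replicate k a) ⟨
    _⊑_ A (replicate k a) w                   ≈⟨ w≃w′ (replicate k a) ⟩
    _⊑_ A (replicate k a) w′                  ≈⟨ ⊑⇔≤∞ mult′ (replicate k a) ⟩
    (∀ b → count b (replicate k a) ≤∞ c′ b)   ≈⟨ replicate-≤∞ c′ k a ⟩
    k ≤∞ c′ a                                 ∎
    where open ⇔-Reasoning

  multiplicity-countable : ∀ {w c} → Multiplicity w c → FinOrCountable A c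
  multiplicity-countable {w} {c} mult = proj₁ ∘ occurrence , injective
    where
      occurrence : (x : Support A c) → ∃ λ i → at w i ≡ just (proj₁ x)
      occurrence (a , ca≢0) with Equivalence.from (mult a 1) (≢fin0⇒1≤∞ (c a) ca≢0)
      ... | n , pos = let i , found = ∈⇒!! (count⁺⇒∈ {a} {prefix n w} pos) in i , prefix-!! n w found
      injective : ∀ x y → proj₁ (occurrence x) ≡ proj₁ (occurrence y) → proj₁ x ≡ proj₁ y
      injective x y same = just-injective (trans (sym (proj₂ (occurrence x)))
                             (subst (λ i → at w i ≡ just (proj₁ y)) (sym same) (proj₂ (occurrence y))))

  AtLeast-limit : ∀ {P w} → IsLimit P w → ∀ a k → AtLeast k a w ⇔ ∃ λ t → k ≤ count a (P t)
  AtLeast-limit {P} {w} (prefix-stage , stage-prefix) a k = mk⇔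
    (λ (n , k≤) → let t , prefix≡ = prefix-stage n in
      t , ≤-trans k≤ (subst (λ v → count a v ≤ count a (P t)) (sym prefix≡) (count-take-≤ a n (P t))))
    (λ (t , k≤) → let n , prefix≡ = stage-prefix t in n , subst (λ v → k ≤ count a v) (sym prefix≡) k≤)

module _ (lem : LEM) {A : Set} where
  open Counting (LEM⇒DecidableEquality lem A)

  multiplicity : (w : A∞ A) → Σ (A → ℕ∞) (Multiplicity w)
  multiplicity w = (λ a → proj₁ (bound a)) , λ a → proj₂ (bound a)
    where
      bound : ∀ a → Σ ℕ∞ λ v → ∀ k → AtLeast k a w ⇔ k ≤∞ v
      bound a = downClosed⇒≤∞ lem (λ k → AtLeast k a w) (AtLeast-zero w) (AtLeast-≤ w)

-- The word of a multiset

-- Offsetting by the index n keeps every stage finite: only letters of index below t occur in stage t.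
copies : ℕ → ℕ∞ → ℕ → ℕ
copies n v t = (t ∸ n) ⊓∞ v

released : ℕ → ℕ∞ → ℕ → ℕ
released n v t = copies n v (suc t) ∸ copies n v t

copies-suc : ∀ n v t → copies n v (suc t) ≡ copies n v t + released n v t
copies-suc n v t = sym (m+[n∸m]≡n (⊓∞-monoˡ-≤ v (∸-monoˡ-≤ n (n≤1+n t))))

released-early : ∀ {n t} v → t < n → released n v t ≡ 0
released-early {n} {t} v t<n rewrite m≤n⇒m∸n≡0 t<n | 0⊓∞v≡0 v = 0∸n≡0 (copies n v t)

copies-reach : ∀ n v {k} → k ≤∞ v ⇔ ∃ λ t → k ≤ copies n v t
copies-reach n v {k} = mk⇔
  (λ k≤v → k + n , ≤-reflexive (sym (trans (cong (_⊓∞ v) (m+n∸n≡m k n)) (≤∞⇒⊓∞≡ v k≤v))))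
  (λ (t , k≤copies) → ≤-≤∞-trans v k≤copies (⊓∞-≤∞ (t ∸ n) v))

module _ (lem : LEM) {A : Set} (c : A → ℕ∞) (c-countable : FinOrCountable A c) where
  open Counting (LEM⇒DecidableEquality lem A)

  -- Deciding c a ≡ fin 0 once per letter makes the index independent of the proof of c a ≢ fin 0:
  -- without function extensionality the injection may send two such proofs to different numbers.
  index : A → Maybe ℕ
  index a with lem (c a ≡ fin 0)
  ... | yes _    = nothing
  ... | no ca≢0 = just (proj₁ c-countable (a , ca≢0))

  index-injective : ∀ {a b n} → index a ≡ just n → index b ≡ just n → a ≡ b
  index-injective {a} {b} with lem (c a ≡ fin 0) | lem (c b ≡ fin 0)
  ... | no _  | no _  = λ { refl b↦n → proj₂ c-countable _ _ (just-injective (sym b↦n)) }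
  ... | yes _ | _     = λ ()
  ... | no _  | yes _ = λ _ ()

  index-nothing : ∀ {a} → index a ≡ nothing → c a ≡ fin 0
  index-nothing {a} with lem (c a ≡ fin 0)
  ... | yes ca≡0 = λ _ → ca≡0
  ... | no _     = λ ()

  index-functional : ∀ {a m n} → index a ≡ just m → index a ≡ just n → m ≡ n
  index-functional a↦m a↦n = just-injective (trans (sym a↦m) a↦n)

  emit : ℕ → ℕ → List A
  emit n t with lem (∃ λ b → index b ≡ just n)
  ... | yes (b , _) = replicate (released n (c b) t) b
  ... | no _        = []

  count-emit-index : ∀ {a n} t → index a ≡ just n → count a (emit n t) ≡ released n (c a) t
  count-emit-index {a} {n} t a↦n with lem (∃ λ b → index b ≡ just n)
  ... | no none = ⊥-elim (none (a , a↦n))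
  ... | yes (b , b↦n) with index-injective b↦n a↦n
  ... | refl = count-replicate b _

  count-emit-other : ∀ {a n} t → ¬ index a ≡ just n → count a (emit n t) ≡ 0
  count-emit-other {a} {n} t a↛n with lem (∃ λ b → index b ≡ just n)
  ... | no _          = refl
  ... | yes (b , b↦n) = count-replicate-≢ {b} {a} (λ { refl → a↛n b↦n }) (released n (c b) t)

  block : ℕ → ℕ → List A
  block t zero    = []
  block t (suc n) = block t n ++ emit n t

  stage : ℕ → List A
  stage zero    = []
  stage (suc t) = stage t ++ block t (suc t)

  count-block-other : ∀ {a} t N → (∀ n → n < N → ¬ index a ≡ just n) → count a (block t N) ≡ 0
  count-block-other     t zero    _      = refl
  count-block-other {a} t (suc N) others = trans (count-++ a (block t N) (emit N t))
    (cong₂ _+_ (count-block-other t N λ n n<N → others n (m<n⇒m<1+n n<N))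
               (count-emit-other t (others N ≤-refl)))

  count-block-index : ∀ {a g} t N → index a ≡ just g → g < N → count a (block t N) ≡ released g (c a) t
  count-block-index {a} {g} t (suc N) a↦g g<N+1 with m<1+n⇒m<n∨m≡n g<N+1
  ... | inj₁ g<N  = trans (count-++ a (block t N) (emit N t))
    (trans (cong₂ _+_ (count-block-index t N a↦g g<N)
                      (count-emit-other t λ a↦N → <⇒≢ g<N (index-functional a↦g a↦N)))
           (+-identityʳ _))
  ... | inj₂ refl = trans (count-++ a (block t g) (emit g t))
    (cong₂ _+_ (count-block-other t g λ n n<g a↦n → <⇒≢ n<g (index-functional a↦n a↦g))
               (count-emit-index t a↦g))

  count-new-block : ∀ {a g} t → index a ≡ just g → count a (block t (suc t)) ≡ released g (c a) t
  count-new-block {a} {g} t a↦g with g ≤? t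
  ... | yes g≤t = count-block-index t (suc t) a↦g (s≤s g≤t)
  ... | no  g≰t = trans
    (count-block-other t (suc t) λ n n≤t a↦n → g≰t (subst (_≤ t) (index-functional a↦n a↦g) (≤-pred n≤t)))
    (sym (released-early (c a) (≰⇒> g≰t)))

  count-stage-index : ∀ {a g} t → index a ≡ just g → count a (stage t) ≡ copies g (c a) t
  count-stage-index {a} {g} zero    a↦g = sym (trans (cong (_⊓∞ c a) (0∸n≡0 g)) (0⊓∞v≡0 (c a)))
  count-stage-index {a} {g} (suc t) a↦g = begin
    count a (stage t ++ block t (suc t))          ≡⟨ count-++ a (stage t) (block t (suc t)) ⟩
    count a (stage t) + count a (block t (suc t)) ≡⟨ cong₂ _+_ (count-stage-index t a↦g) (count-new-block t a↦g) ⟩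
    copies g (c a) t + released g (c a) t         ≡⟨ copies-suc g (c a) t ⟨
    copies g (c a) (suc t)                        ∎
    where open ≡-Reasoning

  count-stage-outside : ∀ {a} t → index a ≡ nothing → count a (stage t) ≡ 0
  count-stage-outside     zero    _   = refl
  count-stage-outside {a} (suc t) a↦∅ = trans (count-++ a (stage t) (block t (suc t)))
    (cong₂ _+_ (count-stage-outside t a↦∅)
               (count-block-other t (suc t) λ n _ a↦n → nothing≢just (trans (sym a↦∅) a↦n)))
    where
      nothing≢just : ∀ {n} → ¬ nothing ≡ just n
      nothing≢just ()

  count-stage : ∀ a → ∃ λ g → ∀ t → count a (stage t) ≡ copies g (c a) t
  count-stage a with index a in a↦
  ... | just g  = g , λ t → count-stage-index t a↦
  ... | nothing = 0 , λ t → trans (count-stage-outside t a↦)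
                              (sym (subst (λ v → copies 0 v t ≡ 0) (sym (index-nothing a↦)) (⊓-zeroʳ t)))

  stage-chain : IsChain stage
  stage-chain t = block t (suc t) , refl

  wordOf : A∞ A
  wordOf = proj₁ (chain-limit lem stage-chain)

  wordOf-IsLimit : IsLimit stage wordOf
  wordOf-IsLimit = proj₂ (chain-limit lem stage-chain)

  wordOf-multiplicity : Multiplicity wordOf c
  wordOf-multiplicity a k with count-stage a
  ... | g , count≡copies = begin
    AtLeast k a wordOf               ≈⟨ AtLeast-limit {stage} {wordOf} wordOf-IsLimit a k ⟩
    (∃ λ t → k ≤ count a (stage t))  ≈⟨ mk⇔ (map₂ λ {t} → subst (k ≤_) (count≡copies t))
                                             (map₂ λ {t} → subst (k ≤_) (sym (count≡copies t))) ⟩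
    (∃ λ t → k ≤ copies g (c a) t)   ≈⟨ copies-reach g (c a) ⟨
    k ≤∞ c a                         ∎
    where open ⇔-Reasoning

proposition1 : LEM → (A : Set) → Bijection (ℵ!-Setoid A) (A∞/≃ A)
proposition1 lem A = record
  { to        = word
  ; cong      = λ {m} {m′} → same-multiplicity⇒≃ (word-multiplicity m) (word-multiplicity m′)
  ; bijective = (λ {m} {m′} → ≃⇒same-multiplicity (word-multiplicity m) (word-multiplicity m′))
              , λ w → let c , mult = multiplicity lem w in
                      (c , multiplicity-countable {w} mult)
                    , λ {m} → same-multiplicity⇒≃ (word-multiplicity m) mult
  }
  where
    open Counting (LEM⇒DecidableEquality lem A)
    word : ℵ! A → A∞ A
    word (c , c-countable) = wordOf lem c c-countable
    word-multiplicity : (m : ℵ! A) → Multiplicity (word m) (proj₁ m)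
    word-multiplicity (c , c-countable) = wordOf-multiplicity lem c c-countable
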